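{- Let $k\in\mathbb{Z}$. For all $x,n\in\mathbb{N}$, $$(-1)^{x-1}G_{n}^{(k)}(x)+G_{n}^{(k)}=2\sum_{m=1}^{n}\sum_{j=1}^{m}\sum_{i=0}^{x-1}(-1)^{i}i^{n-m}\binom{n}{m}\frac{S_{1}(m,j)}{j^{k-1}},$$ with the convention $0^0=1$.
   Context: For $k\in\mathbb{Z}$, $\mathrm{Ei}_k(x)=\sum_{n=1}^{\infty}\frac{x^n}{n^k (n-1)!}$; the poly-Genocchi polynomials $G_n^{(k)}(x)$ are defined by $\frac{2\,\mathrm{Ei}_k(\log(1+t))}{e^t+1}e^{xt}=\sum_{n=0}^{\infty}G_n^{(k)}(x)\frac{t^n}{n!}$, and $G_n^{(k)}=G_n^{(k)}(0)$. $S_1(n,m)$ are the signed Stirling numbers of the first kind: $\frac{(\log(1+t))^m}{m!}=\sum_{n\ge m}S_1(n,m)\frac{t^n}{n!}$. -}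

module Defs where

open import Data.Nat as ℕ using (ℕ; zero; suc; _≤ᵇ_)
open import Data.Nat.Combinatorics using (_C_)

open import Data.Integer as ℤ using (ℤ; +_; -[1+_])
open import Data.Rational as ℚ using (ℚ; 0ℚ; 1ℚ; _+_; _*_; -_; _-_; 1/_; ≢-nonZero)
open import Data.Rational.Properties using (_≟_)
open import Data.Bool using (if_then_else_)
open import Relation.Nullary using (yes; no)

ℕ→ℚ : ℕ → ℚ
ℕ→ℚ n = (+ n) ℚ./ 1

-- total inverse (inv 0 = 0); only ever applied to nonzero arguments below
inv : ℚ → ℚ
inv p with p ≟ 0ℚ
... | yes _ = 0ℚ
... | no p≢0 = 1/_ p {{≢-nonZero p≢0}}

_^_ : ℚ → ℕ → ℚ
q ^ zero = 1ℚ
q ^ suc n = q * (q ^ n)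

_^ᶻ_ : ℚ → ℤ → ℚ
q ^ᶻ (+ n) = q ^ n
q ^ᶻ -[1+ n ] = inv (q ^ suc n)

sgn : ℕ → ℚ
sgn n = (- 1ℚ) ^ n

Σ< : ℕ → (ℕ → ℚ) → ℚ
Σ< zero f = 0ℚ
Σ< (suc n) f = Σ< n f + f n

-- Σ_{i=lo}^{hi} f i  (empty if hi < lo)
Σ[_⋯_] : ℕ → ℕ → (ℕ → ℚ) → ℚ
Σ[ lo ⋯ hi ] f = Σ< (suc hi ℕ.∸ lo) (λ i → f (lo ℕ.+ i))

-- formal power series over ℚ: coefficient sequences
PS : Set
PS = ℕ → ℚ

_⊛_ : PS → PS → PS
(f ⊛ g) n = Σ[ 0 ⋯ n ] (λ i → f i * g (n ℕ.∸ i))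

_^ˢ_ : PS → ℕ → PS
f ^ˢ zero = λ { zero → 1ℚ ; (suc _) → 0ℚ }
f ^ˢ suc m = f ⊛ (f ^ˢ m)

-- composition a(L(t)) of a series a with a series L having L 0 = 0
_∘ˢ_ : PS → PS → PS
(a ∘ˢ L) n = Σ[ 0 ⋯ n ] (λ m → a m * (L ^ˢ m) n)

-- multiplicative inverse of a series with nonzero constant term
-- invAux f n agrees with 1/f on indices ≤ n
invAux : PS → ℕ → PS
invAux f zero = λ _ → inv (f 0)
invAux f (suc n) i =
  if i ≤ᵇ n then invAux f n i
  else (- inv (f 0)) * Σ[ 1 ⋯ suc n ] (λ j → f j * invAux f n (suc n ℕ.∸ j))

invˢ : PS → PS
invˢ f n = invAux f n n

_·ˢ_ : ℚ → PS → PS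
(c ·ˢ f) n = c * f n

logOnePlus : PS
logOnePlus zero = 0ℚ
logOnePlus (suc n) = sgn n * inv (ℕ→ℚ (suc n))

expS : ℚ → PS
expS x n = (x ^ n) * inv (ℕ→ℚ (n ℕ.!))

expPlusOne : PS
expPlusOne zero = ℚ.1ℚ + 1ℚ
expPlusOne (suc n) = expS 1ℚ (suc n)

Ei : ℤ → PS
Ei k zero = 0ℚ
Ei k (suc n) = inv ((ℕ→ℚ (suc n) ^ᶻ k) * ℕ→ℚ (n ℕ.!))

genocchiGF : ℤ → ℚ → PS
genocchiGF k x = (((1ℚ + 1ℚ) ·ˢ (Ei k ∘ˢ logOnePlus)) ⊛ invˢ expPlusOne) ⊛ expS x

G : ℤ → ℕ → ℚ → ℚ
G k n x = ℕ→ℚ (n ℕ.!) * genocchiGF k x n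

G₀ : ℤ → ℕ → ℚ
G₀ k n = G k n 0ℚ

-- signed Stirling numbers of the first kind:
-- (log(1+t))^m / m! = Σ_{n≥m} S₁(n,m) t^n / n!
S₁ : ℕ → ℕ → ℚ
S₁ n m = ℕ→ℚ (n ℕ.!) * (inv (ℕ→ℚ (m ℕ.!)) * (logOnePlus ^ˢ m) n)

-- Multiplying the generating function of the poly-Genocchi polynomials by
-- (-1)^(x-1) e^(xt) + 1 = (e^t + 1) Σ_{i<x} (-1)^i e^(it) (a telescoping sum)
-- cancels the denominator e^t + 1 and leaves 2 Ei_k(log(1+t)) Σ_{i<x} (-1)^i e^(it).
-- Since Ei_k(log(1+t)) = Σ_m (t^m/m!) Σ_{j≤m} S₁(m,j)/j^(k-1), comparing
-- exponential coefficients of this product (a binomial convolution) gives the formula.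

module Submission where

open import Defs
open import Data.Nat as ℕ using (ℕ; zero; suc; _!)
open import Data.Nat.Combinatorics using (_C_; nCk≡n!/k![n-k]!; k![n∸k]!∣n!)
import Data.Nat.DivMod as ℕDivMod
import Data.Nat.Properties as ℕP
open import Data.Fin using (toℕ)
open import Data.Integer as ℤ using (ℤ; -[1+_])
import Data.Integer.Properties as ℤP
open import Data.Rational as ℚ using (ℚ; 0ℚ; 1ℚ; _+_; _*_; -_)
import Data.Rational.Properties as ℚP
open import Data.Rational.Solver using (module +-*-Solver)
open import Data.Rational.Unnormalised as ℚᵘ using (mkℚᵘ; *≡*)
import Data.Rational.Unnormalised.Properties as ℚᵘP
open import Data.Nat.Coprimality as Coprimality using (1-coprimeTo)
open import Data.Bool using (false)
open import Data.Bool.Properties using (T-≡; ¬-not)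
open import Function.Bundles using (Equivalence)
open import Data.Empty using (⊥-elim)
open import Relation.Nullary using (Dec; yes; no)
open import Relation.Binary.PropositionalEquality
open import Algebra.Bundles using (CommutativeRing)
import Algebra.Properties.CommutativeSemiring.Binomial
import Algebra.Properties.Semiring.Exp
import Algebra.Definitions.RawMonoid
import Algebra.Properties.Monoid.Sum
open +-*-Solver
open ≡-Reasoning

-- ℕ→ℚ normalises by a gcd that does not compute on variables, so its
-- arithmetic is checked in the unnormalised rationals.
toℚᵘ-ℕ→ℚ : ∀ n → ℚ.toℚᵘ (ℕ→ℚ n) ≡ mkℚᵘ (ℤ.+ n) 0
toℚᵘ-ℕ→ℚ n = cong ℚ.toℚᵘ (ℚP.normalize-coprime (Coprimality.sym (1-coprimeTo n)))

ℕ→ℚ-+ : ∀ m n → ℕ→ℚ (m ℕ.+ n) ≡ ℕ→ℚ m + ℕ→ℚ n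
ℕ→ℚ-+ m n =
  ℚP.toℚᵘ-injective (ℚᵘP.≃-trans unnormalised (ℚᵘP.≃-sym (ℚP.toℚᵘ-homo-+ (ℕ→ℚ m) (ℕ→ℚ n))))
  where
  open import Data.Integer.Base using (+_)
  numerators : + (m ℕ.+ n) ℤ.* + 1 ≡ (+ m ℤ.* + 1 ℤ.+ + n ℤ.* + 1) ℤ.* + 1
  numerators = cong (ℤ._* + 1)
    (trans (ℤP.pos-+ m n) (sym (cong₂ ℤ._+_ (ℤP.*-identityʳ (+ m)) (ℤP.*-identityʳ (+ n)))))
  unnormalised : ℚ.toℚᵘ (ℕ→ℚ (m ℕ.+ n)) ℚᵘ.≃ ℚ.toℚᵘ (ℕ→ℚ m) ℚᵘ.+ ℚ.toℚᵘ (ℕ→ℚ n)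
  unnormalised rewrite toℚᵘ-ℕ→ℚ (m ℕ.+ n) | toℚᵘ-ℕ→ℚ m | toℚᵘ-ℕ→ℚ n = *≡* numerators

ℕ→ℚ-* : ∀ m n → ℕ→ℚ (m ℕ.* n) ≡ ℕ→ℚ m * ℕ→ℚ n
ℕ→ℚ-* zero    n = sym (ℚP.*-zeroˡ (ℕ→ℚ n))
ℕ→ℚ-* (suc m) n = begin
  ℕ→ℚ (n ℕ.+ m ℕ.* n)            ≡⟨ trans (ℕ→ℚ-+ n (m ℕ.* n)) (cong (ℕ→ℚ n +_) (ℕ→ℚ-* m n)) ⟩
  ℕ→ℚ n + ℕ→ℚ m * ℕ→ℚ n          ≡⟨ solve 2 (λ a b → b :+ a :* b := (con 1ℚ :+ a) :* b) refl (ℕ→ℚ m) (ℕ→ℚ n) ⟩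
  (1ℚ + ℕ→ℚ m) * ℕ→ℚ n           ≡⟨ cong (_* ℕ→ℚ n) (sym (ℕ→ℚ-+ 1 m)) ⟩
  ℕ→ℚ (suc m) * ℕ→ℚ n            ∎

ℕ→ℚ-suc≢0 : ∀ n → ℕ→ℚ (suc n) ≢ 0ℚ
ℕ→ℚ-suc≢0 n eq with trans (sym (cong ℚ.toℚᵘ eq)) (toℚᵘ-ℕ→ℚ (suc n))
... | ()

ℕ→ℚ-!≢0 : ∀ n → ℕ→ℚ (n !) ≢ 0ℚ
ℕ→ℚ-!≢0 n with n ! | ℕP.1≤n! n
... | suc m | _ = ℕ→ℚ-suc≢0 m

*-inv : ∀ {p} → p ≢ 0ℚ → p * inv p ≡ 1ℚ
*-inv {p} p≢0 with p ℚP.≟ 0ℚ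
... | yes p≡0 = ⊥-elim (p≢0 p≡0)
... | no  p≢0 = ℚP.*-inverseʳ p {{ℚ.≢-nonZero p≢0}}

inv-unique : ∀ {p q} → p * q ≡ 1ℚ → inv p ≡ q
inv-unique {p} {q} pq≡1 = begin
  inv p                ≡⟨ sym (ℚP.*-identityˡ (inv p)) ⟩
  1ℚ * inv p           ≡⟨ cong (_* inv p) (sym pq≡1) ⟩
  p * q * inv p        ≡⟨ solve 3 (λ p q i → p :* q :* i := p :* i :* q) refl p q (inv p) ⟩
  p * inv p * q        ≡⟨ cong (_* q) (*-inv p≢0) ⟩
  1ℚ * q               ≡⟨ ℚP.*-identityˡ q ⟩
  q                    ∎
  where
  p≢0 : p ≢ 0ℚ
  p≢0 refl = ℚP.1≢0 (trans (sym pq≡1) (ℚP.*-zeroˡ q))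

inv-distrib-* : ∀ p q → inv (p * q) ≡ inv p * inv q
inv-distrib-* p q = by-cases (p ℚP.≟ 0ℚ) (q ℚP.≟ 0ℚ)
  where
  by-cases : Dec (p ≡ 0ℚ) → Dec (q ≡ 0ℚ) → inv (p * q) ≡ inv p * inv q
  by-cases (yes refl) _ = trans (cong inv (ℚP.*-zeroˡ q)) (sym (ℚP.*-zeroˡ (inv q)))
  by-cases (no _) (yes refl) = trans (cong inv (ℚP.*-zeroʳ p)) (sym (ℚP.*-zeroʳ (inv p)))
  by-cases (no p≢0) (no q≢0) = inv-unique {p * q} (begin
    p * q * (inv p * inv q)    ≡⟨ solve 4 (λ p q i j → p :* q :* (i :* j) := (p :* i) :* (q :* j)) refl p q (inv p) (inv q) ⟩
    p * inv p * (q * inv q)    ≡⟨ cong₂ _*_ (*-inv p≢0) (*-inv q≢0) ⟩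
    1ℚ                         ∎)

*-cancelˡ : ∀ {p q r} → p ≢ 0ℚ → p * q ≡ p * r → q ≡ r
*-cancelˡ {p} {q} {r} p≢0 pq≡pr = begin
  q                  ≡⟨ sym (unit q) ⟩
  inv p * (p * q)    ≡⟨ cong (inv p *_) pq≡pr ⟩
  inv p * (p * r)    ≡⟨ unit r ⟩
  r                  ∎
  where
  unit : ∀ s → inv p * (p * s) ≡ s
  unit s = trans (solve 3 (λ i p s → i :* (p :* s) := p :* i :* s) refl (inv p) p s)
                 (trans (cong (_* s) (*-inv p≢0)) (ℚP.*-identityˡ s))

^ᶻ-unfold : ∀ {a} → a ≢ 0ℚ → ∀ k → a ^ᶻ k ≡ a * a ^ᶻ (k ℤ.- ℤ.1ℤ)
^ᶻ-unfold {a} a≢0 (ℤ.+ zero) = sym (trans (cong (λ z → a * inv z) (ℚP.*-identityʳ a)) (*-inv a≢0))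
^ᶻ-unfold     a≢0 (ℤ.+ suc n) = refl
^ᶻ-unfold {a} a≢0 -[1+ n ] = begin
  inv (a ^ suc n)                      ≡⟨ sym (ℚP.*-identityˡ _) ⟩
  1ℚ * inv (a ^ suc n)                 ≡⟨ cong (_* inv (a ^ suc n)) (sym (*-inv a≢0)) ⟩
  a * inv a * inv (a ^ suc n)          ≡⟨ ℚP.*-assoc a (inv a) _ ⟩
  a * (inv a * inv (a ^ suc n))        ≡⟨ cong (a *_) (sym (inv-distrib-* a (a ^ suc n))) ⟩
  a * inv (a ^ suc (suc n))            ≡⟨ cong (λ m → a * inv (a ^ suc (suc m))) (sym (ℕP.+-identityʳ n)) ⟩
  a * a ^ᶻ (-[1+ n ] ℤ.- ℤ.1ℤ)         ∎

-- Finite sums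

Σ<-cong : ∀ n {f g : ℕ → ℚ} → (∀ i → i ℕ.< n → f i ≡ g i) → Σ< n f ≡ Σ< n g
Σ<-cong zero    f≡g = refl
Σ<-cong (suc n) f≡g = cong₂ _+_ (Σ<-cong n (λ i i<n → f≡g i (ℕP.m<n⇒m<1+n i<n))) (f≡g n (ℕP.n<1+n n))

Σ<-ext : ∀ n {f g : ℕ → ℚ} → f ≗ g → Σ< n f ≡ Σ< n g
Σ<-ext n f≗g = Σ<-cong n (λ i _ → f≗g i)

Σ<-distrib-+ : ∀ n (f g : ℕ → ℚ) → Σ< n (λ i → f i + g i) ≡ Σ< n f + Σ< n g
Σ<-distrib-+ zero    f g = sym (ℚP.+-identityˡ 0ℚ)
Σ<-distrib-+ (suc n) f g = trans (cong (_+ (f n + g n)) (Σ<-distrib-+ n f g))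
  (solve 4 (λ F G a b → (F :+ G) :+ (a :+ b) := (F :+ a) :+ (G :+ b)) refl (Σ< n f) (Σ< n g) (f n) (g n))

*-distribˡ-Σ< : ∀ n c (f : ℕ → ℚ) → c * Σ< n f ≡ Σ< n (λ i → c * f i)
*-distribˡ-Σ< zero    c f = ℚP.*-zeroʳ c
*-distribˡ-Σ< (suc n) c f = trans (ℚP.*-distribˡ-+ c (Σ< n f) (f n)) (cong (_+ c * f n) (*-distribˡ-Σ< n c f))

*-distribʳ-Σ< : ∀ n c (f : ℕ → ℚ) → Σ< n f * c ≡ Σ< n (λ i → f i * c)
*-distribʳ-Σ< n c f = begin
  Σ< n f * c              ≡⟨ ℚP.*-comm (Σ< n f) c ⟩
  c * Σ< n f              ≡⟨ *-distribˡ-Σ< n c f ⟩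
  Σ< n (λ i → c * f i)    ≡⟨ Σ<-ext n (λ i → ℚP.*-comm c (f i)) ⟩
  Σ< n (λ i → f i * c)    ∎

Σ<-*-Σ< : ∀ m n (f g : ℕ → ℚ) → Σ< m f * Σ< n g ≡ Σ< m (λ j → Σ< n (λ i → f j * g i))
Σ<-*-Σ< m n f g = trans (*-distribʳ-Σ< m (Σ< n g) f) (Σ<-ext m (λ j → *-distribˡ-Σ< n (f j) g))

Σ<-first : ∀ n (f : ℕ → ℚ) → Σ< (suc n) f ≡ f 0 + Σ< n (λ i → f (suc i))
Σ<-first zero    f = trans (ℚP.+-identityˡ (f 0)) (sym (ℚP.+-identityʳ (f 0)))
Σ<-first (suc n) f = trans (cong (_+ f (suc n)) (Σ<-first n f)) (ℚP.+-assoc (f 0) _ (f (suc n)))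

Σ<-first-zero : ∀ n (f : ℕ → ℚ) → f 0 ≡ 0ℚ → Σ< (suc n) f ≡ Σ< n (λ i → f (suc i))
Σ<-first-zero n f f0≡0 = trans (Σ<-first n f) (trans (cong (_+ Σ< n (λ i → f (suc i))) f0≡0) (ℚP.+-identityˡ _))

Σ<-reverse : ∀ n (f : ℕ → ℚ) → Σ< (suc n) f ≡ Σ< (suc n) (λ i → f (n ℕ.∸ i))
Σ<-reverse zero    f = refl
Σ<-reverse (suc n) f = begin
  Σ< (suc n) f + f (suc n)                     ≡⟨ cong (_+ f (suc n)) (Σ<-reverse n f) ⟩
  Σ< (suc n) (λ i → f (n ℕ.∸ i)) + f (suc n)   ≡⟨ ℚP.+-comm _ (f (suc n)) ⟩
  f (suc n) + Σ< (suc n) (λ i → f (n ℕ.∸ i))   ≡⟨ sym (Σ<-first (suc n) (λ i → f (suc n ℕ.∸ i))) ⟩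
  Σ< (suc (suc n)) (λ i → f (suc n ℕ.∸ i))     ∎

Σ<-triangle : ∀ n (F : ℕ → ℕ → ℚ) →
  Σ< n (λ i → Σ< (n ℕ.∸ i) (F i)) ≡ Σ< n (λ l → Σ< (suc l) (λ i → F i (l ℕ.∸ i)))
Σ<-triangle zero    F = refl
Σ<-triangle (suc n) F = begin
  Σ< (suc n) (λ i → Σ< (suc n ℕ.∸ i) (F i))
    ≡⟨ Σ<-cong (suc n) (λ i i<1+n → cong (λ l → Σ< l (F i)) (ℕP.+-∸-assoc 1 (ℕP.≤-pred i<1+n))) ⟩
  Σ< (suc n) (λ i → Σ< (n ℕ.∸ i) (F i) + F i (n ℕ.∸ i))
    ≡⟨ Σ<-distrib-+ (suc n) (λ i → Σ< (n ℕ.∸ i) (F i)) (λ i → F i (n ℕ.∸ i)) ⟩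
  (rows + Σ< (n ℕ.∸ n) (F n)) + diagonal
    ≡⟨ cong (λ l → (rows + Σ< l (F n)) + diagonal) (ℕP.n∸n≡0 n) ⟩
  (rows + 0ℚ) + diagonal
    ≡⟨ cong (_+ diagonal) (trans (ℚP.+-identityʳ rows) (Σ<-triangle n F)) ⟩
  Σ< n (λ l → Σ< (suc l) (λ i → F i (l ℕ.∸ i))) + diagonal   ∎
  where
  rows diagonal : ℚ
  rows = Σ< n (λ i → Σ< (n ℕ.∸ i) (F i))
  diagonal = Σ< (suc n) (λ i → F i (n ℕ.∸ i))

module Binomial = Algebra.Properties.CommutativeSemiring.Binomial
  (CommutativeRing.commutativeSemiring ℚP.+-*-commutativeRing)
open Binomial using (binomialExpansion)
open Algebra.Properties.Semiring.Exp (CommutativeRing.semiring ℚP.+-*-commutativeRing)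
  renaming (_^_ to _^ˢʳ_)
open Algebra.Definitions.RawMonoid (CommutativeRing.+-rawMonoid ℚP.+-*-commutativeRing)
  using (_×_)
open Algebra.Properties.Monoid.Sum (CommutativeRing.+-monoid ℚP.+-*-commutativeRing)
  using (sum; sum-cong-≗)

^≡^ˢʳ : ∀ a n → a ^ n ≡ a ^ˢʳ n
^≡^ˢʳ a zero    = refl
^≡^ˢʳ a (suc n) = cong (a *_) (^≡^ˢʳ a n)

×≡ℕ→ℚ* : ∀ n a → n × a ≡ ℕ→ℚ n * a
×≡ℕ→ℚ* zero    a = sym (ℚP.*-zeroˡ a)
×≡ℕ→ℚ* (suc n) a = begin
  a + n × a              ≡⟨ cong (a +_) (×≡ℕ→ℚ* n a) ⟩
  a + ℕ→ℚ n * a          ≡⟨ solve 2 (λ a m → a :+ m :* a := (con 1ℚ :+ m) :* a) refl a (ℕ→ℚ n) ⟩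
  (1ℚ + ℕ→ℚ n) * a       ≡⟨ cong (_* a) (sym (ℕ→ℚ-+ 1 n)) ⟩
  ℕ→ℚ (suc n) * a        ∎

Σ<≡sum : ∀ n (f : ℕ → ℚ) → Σ< n f ≡ sum {n} (λ i → f (toℕ i))
Σ<≡sum zero    f = refl
Σ<≡sum (suc n) f = trans (Σ<-first n f) (cong (f 0 +_) (Σ<≡sum n (λ i → f (suc i))))

binomial : ∀ n a b → Σ< (suc n) (λ m → ℕ→ℚ (n C m) * (a ^ m * b ^ (n ℕ.∸ m))) ≡ (a + b) ^ n
binomial n a b = begin
  Σ< (suc n) (λ m → ℕ→ℚ (n C m) * (a ^ m * b ^ (n ℕ.∸ m)))
    ≡⟨ Σ<≡sum (suc n) _ ⟩
  sum {suc n} (λ i → ℕ→ℚ (n C toℕ i) * (a ^ toℕ i * b ^ (n ℕ.∸ toℕ i)))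
    ≡⟨ sum-cong-≗ {suc n} (λ i → sym (binomialTerm≡ (toℕ i))) ⟩
  binomialExpansion a b n
    ≡⟨ sym (Binomial.theorem n a b) ⟩
  (a + b) ^ˢʳ n
    ≡⟨ sym (^≡^ˢʳ (a + b) n) ⟩
  (a + b) ^ n ∎
  where
  binomialTerm≡ : ∀ m → (n C m) × (a ^ˢʳ m * b ^ˢʳ (n ℕ.∸ m)) ≡ ℕ→ℚ (n C m) * (a ^ m * b ^ (n ℕ.∸ m))
  binomialTerm≡ m = trans (×≡ℕ→ℚ* (n C m) _)
    (cong (ℕ→ℚ (n C m) *_) (sym (cong₂ _*_ (^≡^ˢʳ a m) (^≡^ˢʳ b (n ℕ.∸ m)))))

-- Formal power series

δ : PS
δ zero    = 1ℚ
δ (suc _) = 0ℚ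

infixl 6 _+ˢ_
_+ˢ_ : PS → PS → PS
(f +ˢ g) n = f n + g n

⊛-congˡ : ∀ {f f′} g → f ≗ f′ → f ⊛ g ≗ f′ ⊛ g
⊛-congˡ g f≗f′ n = Σ<-ext (suc n) (λ i → cong (_* g (n ℕ.∸ i)) (f≗f′ i))

⊛-congʳ : ∀ f {g g′} → g ≗ g′ → f ⊛ g ≗ f ⊛ g′
⊛-congʳ f g≗g′ n = Σ<-ext (suc n) (λ i → cong (f i *_) (g≗g′ (n ℕ.∸ i)))

⊛-comm : ∀ f g → f ⊛ g ≗ g ⊛ f
⊛-comm f g n = trans (Σ<-reverse n (λ i → f i * g (n ℕ.∸ i)))
  (Σ<-cong (suc n) (λ i i<1+n → trans
    (cong (λ j → f (n ℕ.∸ i) * g j) (ℕP.m∸[m∸n]≡n (ℕP.≤-pred i<1+n)))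
    (ℚP.*-comm (f (n ℕ.∸ i)) (g i))))

⊛-assoc : ∀ f g h → (f ⊛ g) ⊛ h ≗ f ⊛ (g ⊛ h)
⊛-assoc f g h n = begin
  Σ< (suc n) (λ l → (f ⊛ g) l * h (n ℕ.∸ l))
    ≡⟨ Σ<-ext (suc n) (λ l → trans (*-distribʳ-Σ< (suc l) (h (n ℕ.∸ l)) (λ i → f i * g (l ℕ.∸ i)))
         (Σ<-ext (suc l) (λ i → ℚP.*-assoc (f i) (g (l ℕ.∸ i)) (h (n ℕ.∸ l))))) ⟩
  Σ< (suc n) (λ l → Σ< (suc l) (λ i → f i * (g (l ℕ.∸ i) * h (n ℕ.∸ l))))
    ≡⟨ Σ<-ext (suc n) (λ l → Σ<-cong (suc l) (λ i i<1+l →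
         cong (λ j → f i * (g (l ℕ.∸ i) * h j)) (sym (n∸i∸[l∸i]≡n∸l (ℕP.≤-pred i<1+l))))) ⟩
  Σ< (suc n) (λ l → Σ< (suc l) (λ i → F i (l ℕ.∸ i)))
    ≡⟨ sym (Σ<-triangle (suc n) F) ⟩
  Σ< (suc n) (λ i → Σ< (suc n ℕ.∸ i) (F i))
    ≡⟨ Σ<-cong (suc n) (λ i i<1+n → trans (cong (λ l → Σ< l (F i)) (ℕP.+-∸-assoc 1 (ℕP.≤-pred i<1+n)))
         (sym (*-distribˡ-Σ< (suc (n ℕ.∸ i)) (f i) (λ j → g j * h (n ℕ.∸ i ℕ.∸ j))))) ⟩
  Σ< (suc n) (λ i → f i * (g ⊛ h) (n ℕ.∸ i)) ∎
  where
  F : ℕ → ℕ → ℚ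
  F i j = f i * (g j * h (n ℕ.∸ i ℕ.∸ j))
  n∸i∸[l∸i]≡n∸l : ∀ {i l} → i ℕ.≤ l → n ℕ.∸ i ℕ.∸ (l ℕ.∸ i) ≡ n ℕ.∸ l
  n∸i∸[l∸i]≡n∸l {i} {l} i≤l = trans (ℕP.∸-+-assoc n i (l ℕ.∸ i)) (cong (n ℕ.∸_) (ℕP.m+[n∸m]≡n i≤l))

⊛-identityˡ : ∀ f → δ ⊛ f ≗ f
⊛-identityˡ f n = begin
  Σ< (suc n) (λ i → δ i * f (n ℕ.∸ i))
    ≡⟨ Σ<-first n (λ i → δ i * f (n ℕ.∸ i)) ⟩
  1ℚ * f n + Σ< n (λ i → 0ℚ * f (n ℕ.∸ suc i))
    ≡⟨ cong₂ _+_ (ℚP.*-identityˡ (f n)) (trans (sym (*-distribˡ-Σ< n 0ℚ rest)) (ℚP.*-zeroˡ (Σ< n rest))) ⟩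
  f n + 0ℚ
    ≡⟨ ℚP.+-identityʳ (f n) ⟩
  f n ∎
  where
  rest : ℕ → ℚ
  rest i = f (n ℕ.∸ suc i)

⊛-identityʳ : ∀ f → f ⊛ δ ≗ f
⊛-identityʳ f n = trans (⊛-comm f δ n) (⊛-identityˡ f n)

⊛-zeroʳ : ∀ f n → (f ⊛ (λ _ → 0ℚ)) n ≡ 0ℚ
⊛-zeroʳ f n = trans (sym (*-distribʳ-Σ< (suc n) 0ℚ f)) (ℚP.*-zeroʳ (Σ< (suc n) f))

⊛-distribˡ-+ˢ : ∀ f g h → f ⊛ (g +ˢ h) ≗ f ⊛ g +ˢ f ⊛ h
⊛-distribˡ-+ˢ f g h n = trans (Σ<-ext (suc n) (λ i → ℚP.*-distribˡ-+ (f i) (g (n ℕ.∸ i)) (h (n ℕ.∸ i))))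
  (Σ<-distrib-+ (suc n) (λ i → f i * g (n ℕ.∸ i)) (λ i → f i * h (n ℕ.∸ i)))

⊛-distribʳ-+ˢ : ∀ f g h → (g +ˢ h) ⊛ f ≗ g ⊛ f +ˢ h ⊛ f
⊛-distribʳ-+ˢ f g h n = trans (Σ<-ext (suc n) (λ i → ℚP.*-distribʳ-+ (f (n ℕ.∸ i)) (g i) (h i)))
  (Σ<-distrib-+ (suc n) (λ i → g i * f (n ℕ.∸ i)) (λ i → h i * f (n ℕ.∸ i)))

⊛-·ˢ : ∀ f c g → f ⊛ (c ·ˢ g) ≗ c ·ˢ (f ⊛ g)
⊛-·ˢ f c g n = trans
  (Σ<-ext (suc n) (λ i → solve 3 (λ a c b → a :* (c :* b) := c :* (a :* b)) refl (f i) c (g (n ℕ.∸ i))))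
  (sym (*-distribˡ-Σ< (suc n) c (λ i → f i * g (n ℕ.∸ i))))

1+n≤ᵇn≡false : ∀ n → (suc n ℕ.≤ᵇ n) ≡ false
1+n≤ᵇn≡false n = ¬-not (λ 1+n≤ᵇn → ℕP.n≮n n (ℕP.≤ᵇ⇒≤ (suc n) n (Equivalence.from T-≡ 1+n≤ᵇn)))

invAux-stable : ∀ f m i → i ℕ.≤ m → invAux f m i ≡ invˢ f i
invAux-stable f zero    zero _ = refl
invAux-stable f (suc m) i i≤1+m with i ℕ.≤? m
... | yes i≤m rewrite Equivalence.to T-≡ (ℕP.≤⇒≤ᵇ i≤m) = invAux-stable f m i i≤m
... | no  i≰m rewrite ℕP.≤-antisym i≤1+m (ℕP.≰⇒> i≰m) = refl

invˢ-suc : ∀ f n → invˢ f (suc n) ≡ (- inv (f 0)) * Σ< (suc n) (λ i → f (suc i) * invˢ f (n ℕ.∸ i))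
invˢ-suc f n rewrite 1+n≤ᵇn≡false n =
  cong ((- inv (f 0)) *_) (Σ<-ext (suc n) (λ i → cong (f (suc i) *_) (invAux-stable f n (n ℕ.∸ i) (ℕP.m∸n≤m n i))))

⊛-inverseʳ : ∀ f → f 0 ≢ 0ℚ → f ⊛ invˢ f ≗ δ
⊛-inverseʳ f f0≢0 zero    = trans (ℚP.+-identityˡ _) (*-inv f0≢0)
⊛-inverseʳ f f0≢0 (suc n) = begin
  (f ⊛ invˢ f) (suc n)
    ≡⟨ Σ<-first (suc n) (λ i → f i * invˢ f (suc n ℕ.∸ i)) ⟩
  f 0 * invˢ f (suc n) + S
    ≡⟨ cong (λ z → f 0 * z + S) (invˢ-suc f n) ⟩
  f 0 * ((- inv (f 0)) * S) + S
    ≡⟨ solve 3 (λ a b s → a :* ((:- b) :* s) :+ s := (con 1ℚ :+ (:- (a :* b))) :* s) refl (f 0) (inv (f 0)) S ⟩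
  (1ℚ + (- (f 0 * inv (f 0)))) * S
    ≡⟨ cong (λ z → (1ℚ + (- z)) * S) (*-inv f0≢0) ⟩
  (1ℚ + (- 1ℚ)) * S
    ≡⟨ ℚP.*-zeroˡ S ⟩
  0ℚ ∎
  where
  S : ℚ
  S = Σ< (suc n) (λ i → f (suc i) * invˢ f (n ℕ.∸ i))

⊛-invˢ-cancelʳ : ∀ f g → g 0 ≢ 0ℚ → (f ⊛ invˢ g) ⊛ g ≗ f
⊛-invˢ-cancelʳ f g g0≢0 n = begin
  ((f ⊛ invˢ g) ⊛ g) n    ≡⟨ ⊛-assoc f (invˢ g) g n ⟩
  (f ⊛ (invˢ g ⊛ g)) n    ≡⟨ ⊛-congʳ f (λ m → trans (⊛-comm (invˢ g) g m) (⊛-inverseʳ g g0≢0 m)) n ⟩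
  (f ⊛ δ) n               ≡⟨ ⊛-identityʳ f n ⟩
  f n                     ∎

egf : PS → PS
egf f n = ℕ→ℚ (n !) * f n

egf-injective : ∀ {f g} n → egf f n ≡ egf g n → f n ≡ g n
egf-injective n = *-cancelˡ (ℕ→ℚ-!≢0 n)

n!≡nCk*k!*[n∸k]! : ∀ {n k} → k ℕ.≤ n → ℕ→ℚ (n !) ≡ ℕ→ℚ (n C k) * (ℕ→ℚ (k !) * ℕ→ℚ ((n ℕ.∸ k) !))
n!≡nCk*k!*[n∸k]! {n} {k} k≤n = begin
  ℕ→ℚ (n !)                                           ≡⟨ cong ℕ→ℚ (sym inℕ) ⟩
  ℕ→ℚ ((n C k) ℕ.* (k ! ℕ.* (n ℕ.∸ k) !))             ≡⟨ ℕ→ℚ-* (n C k) _ ⟩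
  ℕ→ℚ (n C k) * ℕ→ℚ (k ! ℕ.* (n ℕ.∸ k) !)             ≡⟨ cong (ℕ→ℚ (n C k) *_) (ℕ→ℚ-* (k !) _) ⟩
  ℕ→ℚ (n C k) * (ℕ→ℚ (k !) * ℕ→ℚ ((n ℕ.∸ k) !))      ∎
  where
  inℕ : (n C k) ℕ.* (k ! ℕ.* (n ℕ.∸ k) !) ≡ n !
  inℕ = trans (cong (ℕ._* (k ! ℕ.* (n ℕ.∸ k) !)) (nCk≡n!/k![n-k]! k≤n))
    (ℕDivMod.m/n*n≡m {{ℕP._!*_!≢0 k (n ℕ.∸ k)}} (k![n∸k]!∣n! k≤n))

egf-⊛ : ∀ f g n → egf (f ⊛ g) n ≡ Σ< (suc n) (λ m → ℕ→ℚ (n C m) * (egf f m * egf g (n ℕ.∸ m)))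
egf-⊛ f g n = trans (*-distribˡ-Σ< (suc n) (ℕ→ℚ (n !)) (λ m → f m * g (n ℕ.∸ m)))
  (Σ<-cong (suc n) (λ m m<1+n → summand (ℕP.≤-pred m<1+n)))
  where
  summand : ∀ {m} → m ℕ.≤ n → ℕ→ℚ (n !) * (f m * g (n ℕ.∸ m)) ≡ ℕ→ℚ (n C m) * (egf f m * egf g (n ℕ.∸ m))
  summand {m} m≤n = begin
    ℕ→ℚ (n !) * (f m * g (n ℕ.∸ m))
      ≡⟨ cong (_* (f m * g (n ℕ.∸ m))) (n!≡nCk*k!*[n∸k]! m≤n) ⟩
    ℕ→ℚ (n C m) * (ℕ→ℚ (m !) * ℕ→ℚ ((n ℕ.∸ m) !)) * (f m * g (n ℕ.∸ m))
      ≡⟨ solve 5 (λ c a b x y → c :* (a :* b) :* (x :* y) := c :* ((a :* x) :* (b :* y))) refl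
           (ℕ→ℚ (n C m)) (ℕ→ℚ (m !)) (ℕ→ℚ ((n ℕ.∸ m) !)) (f m) (g (n ℕ.∸ m)) ⟩
    ℕ→ℚ (n C m) * (egf f m * egf g (n ℕ.∸ m))
      ∎

-- Exponential series

egf-expS : ∀ a n → egf (expS a) n ≡ a ^ n
egf-expS a n = begin
  N * (a ^ n * inv N)    ≡⟨ solve 3 (λ f p i → f :* (p :* i) := p :* (f :* i)) refl N (a ^ n) (inv N) ⟩
  a ^ n * (N * inv N)    ≡⟨ cong (a ^ n *_) (*-inv (ℕ→ℚ-!≢0 n)) ⟩
  a ^ n * 1ℚ             ≡⟨ ℚP.*-identityʳ (a ^ n) ⟩
  a ^ n                  ∎
  where
  N : ℚ
  N = ℕ→ℚ (n !)

expS-⊛-expS : ∀ a b → expS a ⊛ expS b ≗ expS (a + b)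
expS-⊛-expS a b n = egf-injective {expS a ⊛ expS b} {expS (a + b)} n (begin
  egf (expS a ⊛ expS b) n
    ≡⟨ egf-⊛ (expS a) (expS b) n ⟩
  Σ< (suc n) (λ m → ℕ→ℚ (n C m) * (egf (expS a) m * egf (expS b) (n ℕ.∸ m)))
    ≡⟨ Σ<-ext (suc n) (λ m → cong (ℕ→ℚ (n C m) *_) (cong₂ _*_ (egf-expS a m) (egf-expS b (n ℕ.∸ m)))) ⟩
  Σ< (suc n) (λ m → ℕ→ℚ (n C m) * (a ^ m * b ^ (n ℕ.∸ m)))
    ≡⟨ binomial n a b ⟩
  (a + b) ^ n
    ≡⟨ sym (egf-expS (a + b) n) ⟩
  egf (expS (a + b)) n ∎)

expPlusOne≗expS₁+δ : expPlusOne ≗ expS 1ℚ +ˢ δ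
expPlusOne≗expS₁+δ zero    = refl
expPlusOne≗expS₁+δ (suc n) = sym (ℚP.+-identityʳ _)

expPlusOne-⊛-expS : ∀ a → expPlusOne ⊛ expS a ≗ expS (1ℚ + a) +ˢ expS a
expPlusOne-⊛-expS a n = begin
  (expPlusOne ⊛ expS a) n                        ≡⟨ ⊛-congˡ (expS a) expPlusOne≗expS₁+δ n ⟩
  ((expS 1ℚ +ˢ δ) ⊛ expS a) n                    ≡⟨ ⊛-distribʳ-+ˢ (expS a) (expS 1ℚ) δ n ⟩
  (expS 1ℚ ⊛ expS a) n + (δ ⊛ expS a) n          ≡⟨ cong₂ _+_ (expS-⊛-expS 1ℚ a n) (⊛-identityˡ (expS a) n) ⟩
  expS (1ℚ + a) n + expS a n                     ∎

alternatingExp : ℕ → PS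
alternatingExp x m = Σ< x (λ i → sgn i * expS (ℕ→ℚ i) m)

expPlusOne-⊛-alternatingExp : ∀ x → expPlusOne ⊛ alternatingExp x ≗ sgn (suc x) ·ˢ expS (ℕ→ℚ x) +ˢ expS 0ℚ
expPlusOne-⊛-alternatingExp zero n =
  trans (⊛-zeroʳ expPlusOne n) (solve 1 (λ e → con 0ℚ := (:- con 1ℚ) :* e :+ e) refl (expS 0ℚ n))
expPlusOne-⊛-alternatingExp (suc x) n = begin
  (expPlusOne ⊛ alternatingExp (suc x)) n
    ≡⟨ ⊛-distribˡ-+ˢ expPlusOne (alternatingExp x) (sgn x ·ˢ eₓ) n ⟩
  (expPlusOne ⊛ alternatingExp x) n + (expPlusOne ⊛ (sgn x ·ˢ eₓ)) n
    ≡⟨ cong₂ _+_ (expPlusOne-⊛-alternatingExp x n) (⊛-·ˢ expPlusOne (sgn x) eₓ n) ⟩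
  (sgn (suc x) * eₓ n + expS 0ℚ n) + sgn x * (expPlusOne ⊛ eₓ) n
    ≡⟨ cong (λ z → (sgn (suc x) * eₓ n + expS 0ℚ n) + sgn x * z) (expPlusOne-⊛-expS (ℕ→ℚ x) n) ⟩
  (sgn (suc x) * eₓ n + expS 0ℚ n) + sgn x * (expS (1ℚ + ℕ→ℚ x) n + eₓ n)
    ≡⟨ cong (λ z → (sgn (suc x) * eₓ n + expS 0ℚ n) + sgn x * (expS z n + eₓ n)) (sym (ℕ→ℚ-+ 1 x)) ⟩
  (sgn (suc x) * eₓ n + expS 0ℚ n) + sgn x * (expS (ℕ→ℚ (suc x)) n + eₓ n)
    ≡⟨ solve 4 (λ s e e₀ e′ → ((:- con 1ℚ) :* s) :* e :+ e₀ :+ s :* (e′ :+ e)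
                          := ((:- con 1ℚ) :* ((:- con 1ℚ) :* s)) :* e′ :+ e₀)
         refl (sgn x) (eₓ n) (expS 0ℚ n) (expS (ℕ→ℚ (suc x)) n) ⟩
  sgn (suc (suc x)) * expS (ℕ→ℚ (suc x)) n + expS 0ℚ n ∎
  where
  eₓ : PS
  eₓ = expS (ℕ→ℚ x)

egf-alternatingExp : ∀ x r → egf (alternatingExp x) r ≡ Σ< x (λ i → sgn i * ℕ→ℚ i ^ r)
egf-alternatingExp x r = trans (*-distribˡ-Σ< x N (λ i → sgn i * expS (ℕ→ℚ i) r)) (Σ<-ext x summand)
  where
  N : ℚ
  N = ℕ→ℚ (r !)
  summand : ∀ i → N * (sgn i * expS (ℕ→ℚ i) r) ≡ sgn i * ℕ→ℚ i ^ r
  summand i = trans (solve 3 (λ f s e → f :* (s :* e) := s :* (f :* e)) refl N (sgn i) (expS (ℕ→ℚ i) r))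
                    (cong (sgn i *_) (egf-expS (ℕ→ℚ i) r))

-- The poly-Genocchi generating function

Ei-suc : ∀ k j → Ei k (suc j) ≡ inv (ℕ→ℚ (suc j !)) * inv (ℕ→ℚ (suc j) ^ᶻ (k ℤ.- ℤ.1ℤ))
Ei-suc k j = begin
  inv (s ^ᶻ k * f)              ≡⟨ cong (λ z → inv (z * f)) (^ᶻ-unfold (ℕ→ℚ-suc≢0 j) k) ⟩
  inv (s * w * f)               ≡⟨ cong inv (solve 3 (λ s w f → s :* w :* f := s :* f :* w) refl s w f) ⟩
  inv (s * f * w)               ≡⟨ cong (λ z → inv (z * w)) (sym (ℕ→ℚ-* (suc j) (j !))) ⟩
  inv (ℕ→ℚ (suc j !) * w)       ≡⟨ inv-distrib-* (ℕ→ℚ (suc j !)) w ⟩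
  inv (ℕ→ℚ (suc j !)) * inv w   ∎
  where
  s f w : ℚ
  s = ℕ→ℚ (suc j)
  f = ℕ→ℚ (j !)
  w = s ^ᶻ (k ℤ.- ℤ.1ℤ)

egf-Ei∘log : ∀ k m →
  egf (Ei k ∘ˢ logOnePlus) (suc m) ≡ Σ[ 1 ⋯ suc m ] (λ j → S₁ (suc m) j * inv (ℕ→ℚ j ^ᶻ (k ℤ.- ℤ.1ℤ)))
egf-Ei∘log k m = begin
  M * Σ< (suc (suc m)) (λ j → Ei k j * (logOnePlus ^ˢ j) (suc m))
    ≡⟨ cong (M *_) (Σ<-first-zero (suc m) _ (ℚP.*-zeroˡ ((logOnePlus ^ˢ 0) (suc m)))) ⟩
  M * Σ< (suc m) (λ j → Ei k (suc j) * L j)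
    ≡⟨ *-distribˡ-Σ< (suc m) M (λ j → Ei k (suc j) * L j) ⟩
  Σ< (suc m) (λ j → M * (Ei k (suc j) * L j))
    ≡⟨ Σ<-ext (suc m) (λ j → cong (λ e → M * (e * L j)) (Ei-suc k j)) ⟩
  Σ< (suc m) (λ j → M * (inv (ℕ→ℚ (suc j !)) * W j * L j))
    ≡⟨ Σ<-ext (suc m) (λ j → solve 4 (λ M i w l → M :* (i :* w :* l) := M :* (i :* l) :* w)
                                     refl M (inv (ℕ→ℚ (suc j !))) (W j) (L j)) ⟩
  Σ< (suc m) (λ j → S₁ (suc m) (suc j) * W j) ∎
  where
  M : ℚ
  M = ℕ→ℚ (suc m !)
  L W : ℕ → ℚ
  L j = (logOnePlus ^ˢ suc j) (suc m)
  W j = inv (ℕ→ℚ (suc j) ^ᶻ (k ℤ.- ℤ.1ℤ))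

twiceEiLog : ℤ → PS
twiceEiLog k = (1ℚ + 1ℚ) ·ˢ (Ei k ∘ˢ logOnePlus)

genocchiGF-alternating : ∀ k x →
  sgn (suc x) ·ˢ genocchiGF k (ℕ→ℚ x) +ˢ genocchiGF k 0ℚ ≗ twiceEiLog k ⊛ alternatingExp x
genocchiGF-alternating k x n = begin
  sgn (suc x) * (A ⊛ expS (ℕ→ℚ x)) n + (A ⊛ expS 0ℚ) n
    ≡⟨ cong (_+ (A ⊛ expS 0ℚ) n) (sym (⊛-·ˢ A (sgn (suc x)) (expS (ℕ→ℚ x)) n)) ⟩
  (A ⊛ (sgn (suc x) ·ˢ expS (ℕ→ℚ x))) n + (A ⊛ expS 0ℚ) n
    ≡⟨ sym (⊛-distribˡ-+ˢ A (sgn (suc x) ·ˢ expS (ℕ→ℚ x)) (expS 0ℚ) n) ⟩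
  (A ⊛ (sgn (suc x) ·ˢ expS (ℕ→ℚ x) +ˢ expS 0ℚ)) n
    ≡⟨ sym (⊛-congʳ A (expPlusOne-⊛-alternatingExp x) n) ⟩
  (A ⊛ (expPlusOne ⊛ alternatingExp x)) n
    ≡⟨ sym (⊛-assoc A expPlusOne (alternatingExp x) n) ⟩
  ((A ⊛ expPlusOne) ⊛ alternatingExp x) n
    ≡⟨ ⊛-congˡ (alternatingExp x) (⊛-invˢ-cancelʳ (twiceEiLog k) expPlusOne (λ ())) n ⟩
  (twiceEiLog k ⊛ alternatingExp x) n ∎
  where
  A : PS
  A = twiceEiLog k ⊛ invˢ expPlusOne

egf-twiceEiLog : ∀ k m →
  egf (twiceEiLog k) (suc m) ≡ (1ℚ + 1ℚ) * Σ[ 1 ⋯ suc m ] (λ j → S₁ (suc m) j * inv (ℕ→ℚ j ^ᶻ (k ℤ.- ℤ.1ℤ)))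
egf-twiceEiLog k m = trans
  (solve 3 (λ M t b → M :* (t :* b) := t :* (M :* b)) refl (ℕ→ℚ (suc m !)) (1ℚ + 1ℚ) ((Ei k ∘ˢ logOnePlus) (suc m)))
  (cong ((1ℚ + 1ℚ) *_) (egf-Ei∘log k m))

twiceEiLog-alternatingExp-summand : ∀ k x n m →
  ℕ→ℚ (n C suc m) * (egf (twiceEiLog k) (suc m) * egf (alternatingExp x) (n ℕ.∸ suc m))
    ≡ (1ℚ + 1ℚ) * Σ[ 1 ⋯ suc m ] (λ j → Σ< x (λ i →
        sgn i * (ℕ→ℚ i ^ (n ℕ.∸ suc m)) * ℕ→ℚ (n C suc m) * (S₁ (suc m) j * inv (ℕ→ℚ j ^ᶻ (k ℤ.- ℤ.1ℤ)))))
twiceEiLog-alternatingExp-summand k x n m = begin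
  c * (egf (twiceEiLog k) (suc m) * egf (alternatingExp x) r)
    ≡⟨ cong₂ (λ a b → c * (a * b)) (egf-twiceEiLog k m) (egf-alternatingExp x r) ⟩
  c * ((1ℚ + 1ℚ) * Σ< (suc m) s * Σ< x p)
    ≡⟨ solve 4 (λ t c a b → c :* (t :* a :* b) := t :* (a :* (b :* c))) refl (1ℚ + 1ℚ) c (Σ< (suc m) s) (Σ< x p) ⟩
  (1ℚ + 1ℚ) * (Σ< (suc m) s * (Σ< x p * c))
    ≡⟨ cong (λ z → (1ℚ + 1ℚ) * (Σ< (suc m) s * z)) (*-distribʳ-Σ< x c p) ⟩
  (1ℚ + 1ℚ) * (Σ< (suc m) s * Σ< x (λ i → p i * c))
    ≡⟨ cong ((1ℚ + 1ℚ) *_) (Σ<-*-Σ< (suc m) x s (λ i → p i * c)) ⟩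
  (1ℚ + 1ℚ) * Σ< (suc m) (λ j → Σ< x (λ i → s j * (p i * c)))
    ≡⟨ cong ((1ℚ + 1ℚ) *_) (Σ<-ext (suc m) (λ j → Σ<-ext x (λ i → ℚP.*-comm (s j) (p i * c)))) ⟩
  (1ℚ + 1ℚ) * Σ< (suc m) (λ j → Σ< x (λ i → p i * c * s j)) ∎
  where
  r : ℕ
  r = n ℕ.∸ suc m
  c : ℚ
  c = ℕ→ℚ (n C suc m)
  s p : ℕ → ℚ
  s j = S₁ (suc m) (suc j) * inv (ℕ→ℚ (suc j) ^ᶻ (k ℤ.- ℤ.1ℤ))
  p i = sgn i * ℕ→ℚ i ^ r

egf-twiceEiLog-⊛-alternatingExp : ∀ k x n →
  egf (twiceEiLog k ⊛ alternatingExp x) n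
    ≡ (1ℚ + 1ℚ) * Σ[ 1 ⋯ n ] (λ m → Σ[ 1 ⋯ m ] (λ j → Σ< x (λ i →
        sgn i * (ℕ→ℚ i ^ (n ℕ.∸ m)) * ℕ→ℚ (n C m) * (S₁ m j * inv (ℕ→ℚ j ^ᶻ (k ℤ.- ℤ.1ℤ))))))
egf-twiceEiLog-⊛-alternatingExp k x n = begin
  egf (twiceEiLog k ⊛ alternatingExp x) n
    ≡⟨ egf-⊛ (twiceEiLog k) (alternatingExp x) n ⟩
  Σ< (suc n) (λ m → ℕ→ℚ (n C m) * (egf (twiceEiLog k) m * egf (alternatingExp x) (n ℕ.∸ m)))
    ≡⟨ Σ<-first-zero n _ (trans (cong (ℕ→ℚ (n C 0) *_) (ℚP.*-zeroˡ (egf (alternatingExp x) n)))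
                                (ℚP.*-zeroʳ (ℕ→ℚ (n C 0)))) ⟩
  Σ< n (λ m → ℕ→ℚ (n C suc m) * (egf (twiceEiLog k) (suc m) * egf (alternatingExp x) (n ℕ.∸ suc m)))
    ≡⟨ Σ<-ext n (twiceEiLog-alternatingExp-summand k x n) ⟩
  Σ< n (λ m → (1ℚ + 1ℚ) * Σ[ 1 ⋯ suc m ] (λ j → Σ< x (λ i → term (suc m) j i)))
    ≡⟨ sym (*-distribˡ-Σ< n (1ℚ + 1ℚ) (λ m → Σ[ 1 ⋯ suc m ] (λ j → Σ< x (λ i → term (suc m) j i)))) ⟩
  (1ℚ + 1ℚ) * Σ[ 1 ⋯ n ] (λ m → Σ[ 1 ⋯ m ] (λ j → Σ< x (λ i → term m j i))) ∎
  where
  term : ℕ → ℕ → ℕ → ℚ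
  term m j i = sgn i * (ℕ→ℚ i ^ (n ℕ.∸ m)) * ℕ→ℚ (n C m) * (S₁ m j * inv (ℕ→ℚ j ^ᶻ (k ℤ.- ℤ.1ℤ)))

theorem4 : (k : ℤ) (x n : ℕ) →
    sgn (suc x) * G k n (ℕ→ℚ x) + G₀ k n
    ≡ (1ℚ + 1ℚ) * Σ[ 1 ⋯ n ] (λ m → Σ[ 1 ⋯ m ] (λ j → Σ< x (λ i →
    sgn i * (ℕ→ℚ i ^ (n ℕ.∸ m)) * ℕ→ℚ (n C m) * (S₁ m j * inv (ℕ→ℚ j ^ᶻ (k ℤ.- ℤ.1ℤ))))))
theorem4 k x n = begin
  sgn (suc x) * G k n (ℕ→ℚ x) + G₀ k n
    ≡⟨ solve 4 (λ s N a b → s :* (N :* a) :+ N :* b := N :* (s :* a :+ b)) refl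
         (sgn (suc x)) (ℕ→ℚ (n !)) (genocchiGF k (ℕ→ℚ x) n) (genocchiGF k 0ℚ n) ⟩
  egf (sgn (suc x) ·ˢ genocchiGF k (ℕ→ℚ x) +ˢ genocchiGF k 0ℚ) n
    ≡⟨ cong (ℕ→ℚ (n !) *_) (genocchiGF-alternating k x n) ⟩
  egf (twiceEiLog k ⊛ alternatingExp x) n
    ≡⟨ egf-twiceEiLog-⊛-alternatingExp k x n ⟩
  (1ℚ + 1ℚ) * Σ[ 1 ⋯ n ] (λ m → Σ[ 1 ⋯ m ] (λ j → Σ< x (λ i →
    sgn i * (ℕ→ℚ i ^ (n ℕ.∸ m)) * ℕ→ℚ (n C m) * (S₁ m j * inv (ℕ→ℚ j ^ᶻ (k ℤ.- ℤ.1ℤ)))))) ∎
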